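{- For every formula $\phi\in\Phi$, $\vdash\neg\boxdot\phi\to\Box\neg\boxdot\phi$.
   Context: Fix an infinite set of propositional variables. The set $\Phi$ of formulae is given by $\phi ::= p \mid \neg\phi \mid \phi\to\phi \mid \boxdot\phi \mid \Box\phi$, where $p$ ranges over propositional variables. The logical system consists of all propositional tautologies in the language $\Phi$ together with the axioms (for all formulae $\phi,\psi$): Truth $\Box\phi\to\phi$; Negative Introspection $\neg\Box\phi\to\Box\neg\Box\phi$; Distributivity $\Box(\phi\to\psi)\to(\Box\phi\to\Box\psi)$; Monotonicity $\boxdot\phi\to\Box\phi$; Attainable Positive Introspection $\boxdot\phi\to\boxdot\boxdot\phi$; Attainable Distributivity $\boxdot(\phi\to\psi)\to(\boxdot\phi\to\boxdot\psi)$. The inference rules are Modus Ponens (from $\phi$ and $\phi\to\psi$ infer $\psi$) and Attainable Necessitation (from $\phi$ infer $\boxdot\phi$). We write $\vdash\phi$ if $\phi$ is derivable from the axioms using these two rules. -}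

module Defs where

open import Data.Nat using (ℕ)
open import Data.Bool using (Bool; true; false; not; _∨_)
open import Relation.Binary.PropositionalEquality using (_≡_)

data Form : Set where
  var  : ℕ → Form
  ¬'_  : Form → Form
  _⇒_  : Form → Form → Form
  ⊡_   : Form → Form
  □_   : Form → Form

infixr 5 _⇒_
infix 7 ¬'_ ⊡_ □_

-- Propositional valuation: formulae of the form p, ⊡φ, □φ are treated as
-- propositional atoms; an "atom valuation" assigns a truth value to each.
⟦_⟧ : Form → (Form → Bool) → Bool
⟦ var n ⟧ v = v (var n)
⟦ ¬' φ ⟧ v = not (⟦ φ ⟧ v)
⟦ φ ⇒ ψ ⟧ v = not (⟦ φ ⟧ v) ∨ ⟦ ψ ⟧ v
⟦ ⊡ φ ⟧ v = v (⊡ φ)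
⟦ □ φ ⟧ v = v (□ φ)

Tautology : Form → Set
Tautology φ = ∀ (v : Form → Bool) → ⟦ φ ⟧ v ≡ true

data ⊢_ : Form → Set where
  taut    : ∀ {φ} → Tautology φ → ⊢ φ
  truth   : ∀ φ → ⊢ (□ φ ⇒ φ)
  negIntro : ∀ φ → ⊢ (¬' □ φ ⇒ □ ¬' □ φ)
  distr   : ∀ φ ψ → ⊢ (□ (φ ⇒ ψ) ⇒ (□ φ ⇒ □ ψ))
  mono    : ∀ φ → ⊢ (⊡ φ ⇒ □ φ)
  attPosIntro : ∀ φ → ⊢ (⊡ φ ⇒ ⊡ ⊡ φ)
  attDistr : ∀ φ ψ → ⊢ (⊡ (φ ⇒ ψ) ⇒ (⊡ φ ⇒ ⊡ ψ))
  mp      : ∀ {φ ψ} → ⊢ φ → ⊢ (φ ⇒ ψ) → ⊢ ψ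
  attNec  : ∀ {φ} → ⊢ φ → ⊢ (⊡ φ)

infix 3 ⊢_

-- Truth gives ¬⊡φ → ¬□⊡φ, and negative introspection gives ¬□⊡φ → □¬□⊡φ.
-- It remains to push □ through ¬□⊡φ → ¬⊡φ, the contrapositive of
-- ⊡φ → ⊡⊡φ → □⊡φ; the rule "from ψ infer □ψ" is available because
-- attainable necessitation followed by monotonicity yields it.
module Submission where

open import Defs
open import Data.Bool using (true; false)
open import Relation.Binary.PropositionalEquality using (refl)

⇒-trans-taut : ∀ φ ψ χ → Tautology ((φ ⇒ ψ) ⇒ (ψ ⇒ χ) ⇒ (φ ⇒ χ))
⇒-trans-taut φ ψ χ v with ⟦ φ ⟧ v | ⟦ ψ ⟧ v | ⟦ χ ⟧ v
... | false | false | false = refl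
... | false | false | true  = refl
... | false | true  | false = refl
... | false | true  | true  = refl
... | true  | false | false = refl
... | true  | false | true  = refl
... | true  | true  | false = refl
... | true  | true  | true  = refl

contraposition-taut : ∀ φ ψ → Tautology ((φ ⇒ ψ) ⇒ (¬' ψ ⇒ ¬' φ))
contraposition-taut φ ψ v with ⟦ φ ⟧ v | ⟦ ψ ⟧ v
... | false | false = refl
... | false | true  = refl
... | true  | false = refl
... | true  | true  = refl

⊢-trans : ∀ {φ ψ χ} → ⊢ (φ ⇒ ψ) → ⊢ (ψ ⇒ χ) → ⊢ (φ ⇒ χ)
⊢-trans {φ} {ψ} {χ} φ⇒ψ ψ⇒χ = mp ψ⇒χ (mp φ⇒ψ (taut (⇒-trans-taut φ ψ χ)))

⊢-contrapose : ∀ {φ ψ} → ⊢ (φ ⇒ ψ) → ⊢ (¬' ψ ⇒ ¬' φ)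
⊢-contrapose {φ} {ψ} φ⇒ψ = mp φ⇒ψ (taut (contraposition-taut φ ψ))

□-nec : ∀ {φ} → ⊢ φ → ⊢ □ φ
□-nec {φ} ⊢φ = mp (attNec ⊢φ) (mono φ)

□-mono : ∀ {φ ψ} → ⊢ (φ ⇒ ψ) → ⊢ (□ φ ⇒ □ ψ)
□-mono {φ} {ψ} φ⇒ψ = mp (□-nec φ⇒ψ) (distr φ ψ)

⊡⇒□⊡ : ∀ φ → ⊢ (⊡ φ ⇒ □ ⊡ φ)
⊡⇒□⊡ φ = ⊢-trans (attPosIntro φ) (mono (⊡ φ))

lemma2 : ∀ (φ : Form) → ⊢ (¬' ⊡ φ ⇒ □ ¬' ⊡ φ)
lemma2 φ =
  ⊢-trans (⊢-contrapose (truth (⊡ φ)))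
    (⊢-trans (negIntro (⊡ φ))
      (□-mono (⊢-contrapose (⊡⇒□⊡ φ))))
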